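{- For every integer $m$ and every positive integer $n$, \[ \sum_{j=1}^n\binom{n}{j}\Big\lfloor\frac{j}{2}\Big\rfloor F_{3j+m}=2^{n-2}\big(nF_{2n+m+1}-F_{2n+m}+(-1)^nF_{n+m}\big) \] and \[ \sum_{j=1}^n\binom{n}{j}\Big\lfloor\frac{j}{2}\Big\rfloor L_{3j+m}=2^{n-2}\big(nL_{2n+m+1}-L_{2n+m}+(-1)^nL_{n+m}\big). \]
   Context: $F_n$ and $L_n$ are the Fibonacci and Lucas numbers, defined for all integers $n$ by $F_n=(\alpha^n-\beta^n)/\sqrt5$, $L_n=\alpha^n+\beta^n$ with $\alpha=(1+\sqrt5)/2$, $\beta=(1-\sqrt5)/2$. $\lfloor x\rfloor$ is the floor function. -}

module Defs where

open import Data.Nat as ℕ using (ℕ; zero; suc)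
open import Data.Integer using (ℤ; +_; -[1+_]; _+_; _*_; -_)
open import Data.Nat.Combinatorics using (_C_)

fibℕ : ℕ → ℕ
fibℕ 0 = 0
fibℕ 1 = 1
fibℕ (suc (suc n)) = fibℕ (suc n) ℕ.+ fibℕ n

lucℕ : ℕ → ℕ
lucℕ 0 = 2
lucℕ 1 = 1
lucℕ (suc (suc n)) = lucℕ (suc n) ℕ.+ lucℕ n

sgn : ℕ → ℤ
sgn zero = + 1
sgn (suc k) = - sgn k

-- Extension to all integer indices, matching the Binet formulas:
-- F_{-n} = (-1)^{n+1} F_n,  L_{-n} = (-1)^n L_n
F : ℤ → ℤ
F (+ n) = + fibℕ n
F -[1+ k ] = sgn k * + fibℕ (suc k)

L : ℤ → ℤ
L (+ n) = + lucℕ n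
L -[1+ k ] = sgn (suc k) * + lucℕ (suc k)

sumFrom1 : ℕ → (ℕ → ℤ) → ℤ
sumFrom1 zero f = + 0
sumFrom1 (suc n) f = sumFrom1 n f + f (suc n)

{-# OPTIONS --safe #-}
module Submission where

open import Defs
open import Data.Nat as ℕ using (ℕ; zero; suc; _/_; _^_)
open import Data.Nat.Combinatorics using (_C_; nCk+nC[k+1]≡[n+1]C[k+1]; k>n⇒nCk≡0)
open import Data.Nat.DivMod using (m/n≡1+[m∸n]/n)
open import Data.Nat.Properties using (n<1+n)
open import Data.Integer as ℤ using (ℤ; +_; -[1+_]; _+_; _-_; _*_; -_)
open import Data.Integer.Properties
  using ( +-identityˡ; +-identityʳ; +-assoc; *-identityˡ; *-identityʳ; *-zeroʳ; *-assoc; *-distribˡ-+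
        ; pos-+; pos-*; ^-zeroˡ)
open import Data.Integer.Tactic.RingSolver using (solve-∀)
open import Data.Product using (_×_; _,_)
open import Function using (_∘_)
open import Relation.Binary.PropositionalEquality
  using (_≡_; refl; sym; trans; cong; cong₂; module ≡-Reasoning)

open ≡-Reasoning

-- 4⌊j/2⌋ = 2j − 1 + (−1)^j splits the sum into three binomial sums Σ C(n,j) G(3j+m),
-- Σ C(n,j) (−1)^j G(3j+m) and Σ C(n,j) j G(3j+m), which can be evaluated for any sequence
-- G with G(k+2) = G(k+1) + G(k). The first two are 2^n G(2n+m) and (−2)^n G(n+m), because
-- G(k) + G(k+3) = 2 G(k+2) and G(k) − G(k+3) = −2 G(k+1) (the operator identities
-- 1 + α³ = 2α² and 1 − α³ = −2α); the third reduces to the first by the absorption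
-- identity j C(n,j) = n C(n−1,j−1).

Σ< : ℕ → (ℕ → ℤ) → ℤ
Σ< zero    f = + 0
Σ< (suc k) f = Σ< k f + f k

Σ<-suc : ∀ n (f : ℕ → ℤ) → Σ< (suc n) f ≡ f 0 + sumFrom1 n f
Σ<-suc zero    f = trans (+-identityˡ (f 0)) (sym (+-identityʳ (f 0)))
Σ<-suc (suc n) f = trans (cong (_+ f (suc n)) (Σ<-suc n f)) (+-assoc (f 0) _ _)

sumFrom1-cong : ∀ n {f g : ℕ → ℤ} → (∀ j → f j ≡ g j) → sumFrom1 n f ≡ sumFrom1 n g
sumFrom1-cong zero    f≡g = refl
sumFrom1-cong (suc n) f≡g = cong₂ _+_ (sumFrom1-cong n f≡g) (f≡g (suc n))

Σ<-pascal : ∀ n k (f : ℕ → ℤ) →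
  Σ< (suc k) (λ j → + (suc n C j) * f j)
    ≡ Σ< (suc k) (λ j → + (n C j) * f j) + Σ< k (λ j → + (n C j) * f (suc j))
Σ<-pascal n zero    f = sym (+-identityʳ _)
Σ<-pascal n (suc k) f = begin
  Σ< (suc k) (λ j → + (suc n C j) * f j) + + (suc n C suc k) * f (suc k)
    ≡⟨ cong₂ (λ s c → s + + c * f (suc k)) (Σ<-pascal n k f) (sym (nCk+nC[k+1]≡[n+1]C[k+1] n k)) ⟩
  (A + B) + + (n C k ℕ.+ n C suc k) * f (suc k)
    ≡⟨ cong (λ c → (A + B) + c * f (suc k)) (pos-+ (n C k) (n C suc k)) ⟩
  (A + B) + (+ (n C k) + + (n C suc k)) * f (suc k)
    ≡⟨ regroup A B (+ (n C k)) (+ (n C suc k)) (f (suc k)) ⟩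
  (A + + (n C suc k) * f (suc k)) + (B + + (n C k) * f (suc k)) ∎
  where
  A = Σ< (suc k) (λ j → + (n C j) * f j)
  B = Σ< k (λ j → + (n C j) * f (suc j))
  regroup : ∀ a b c d x → (a + b) + (c + d) * x ≡ (a + d * x) + (b + c * x)
  regroup = solve-∀

-- Σbinom n f = Σ_{j=0}^{n} C(n,j) f(j), defined through Pascal's rule (see Σbinom≡Σ<).
Σbinom : ℕ → (ℕ → ℤ) → ℤ
Σbinom zero    f = f 0
Σbinom (suc n) f = Σbinom n f + Σbinom n (f ∘ suc)

Σbinom≡Σ< : ∀ n (f : ℕ → ℤ) → Σbinom n f ≡ Σ< (suc n) (λ j → + (n C j) * f j)
Σbinom≡Σ< zero    f = sym (trans (+-identityˡ (+ 1 * f 0)) (*-identityˡ (f 0)))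
Σbinom≡Σ< (suc n) f = begin
  Σbinom n f + Σbinom n (f ∘ suc)
    ≡⟨ cong₂ _+_ (Σbinom≡Σ< n f) (Σbinom≡Σ< n (f ∘ suc)) ⟩
  Σ< (suc n) (λ j → + (n C j) * f j) + Σ< (suc n) (λ j → + (n C j) * f (suc j))
    ≡⟨ cong (_+ Σ< (suc n) (λ j → + (n C j) * f (suc j))) vanishing-top-term ⟩
  Σ< (suc (suc n)) (λ j → + (n C j) * f j) + Σ< (suc n) (λ j → + (n C j) * f (suc j))
    ≡⟨ sym (Σ<-pascal n (suc n) f) ⟩
  Σ< (suc (suc n)) (λ j → + (suc n C j) * f j) ∎
  where
  vanishing-top-term : Σ< (suc n) (λ j → + (n C j) * f j)
                     ≡ Σ< (suc n) (λ j → + (n C j) * f j) + + (n C suc n) * f (suc n)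
  vanishing-top-term rewrite k>n⇒nCk≡0 {n} {suc n} (n<1+n n) = sym (+-identityʳ _)

sumFrom1≡Σbinom : ∀ n (f : ℕ → ℤ) → f 0 ≡ + 0 → sumFrom1 n (λ j → + (n C j) * f j) ≡ Σbinom n f
sumFrom1≡Σbinom n f f0≡0 = sym (begin
  Σbinom n f                                   ≡⟨ Σbinom≡Σ< n f ⟩
  Σ< (suc n) (λ j → + (n C j) * f j)           ≡⟨ Σ<-suc n _ ⟩
  + (n C 0) * f 0 + sumFrom1 n (λ j → + (n C j) * f j)
    ≡⟨ cong (λ x → + (n C 0) * x + sumFrom1 n (λ j → + (n C j) * f j)) f0≡0 ⟩
  + (n C 0) * + 0 + sumFrom1 n (λ j → + (n C j) * f j)
    ≡⟨ cong (_+ sumFrom1 n (λ j → + (n C j) * f j)) (*-zeroʳ (+ (n C 0))) ⟩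
  + 0 + sumFrom1 n (λ j → + (n C j) * f j)     ≡⟨ +-identityˡ _ ⟩
  sumFrom1 n (λ j → + (n C j) * f j)           ∎)

Σbinom-cong : ∀ n {f g : ℕ → ℤ} → (∀ j → f j ≡ g j) → Σbinom n f ≡ Σbinom n g
Σbinom-cong zero    f≡g = f≡g 0
Σbinom-cong (suc n) f≡g = cong₂ _+_ (Σbinom-cong n f≡g) (Σbinom-cong n (f≡g ∘ suc))

Σbinom-+ : ∀ n (f g : ℕ → ℤ) → Σbinom n (λ j → f j + g j) ≡ Σbinom n f + Σbinom n g
Σbinom-+ zero    f g = refl
Σbinom-+ (suc n) f g = begin
  Σbinom n (λ j → f j + g j) + Σbinom n (λ j → f (suc j) + g (suc j))
    ≡⟨ cong₂ _+_ (Σbinom-+ n f g) (Σbinom-+ n (f ∘ suc) (g ∘ suc)) ⟩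
  (Σbinom n f + Σbinom n g) + (Σbinom n (f ∘ suc) + Σbinom n (g ∘ suc))
    ≡⟨ interchange (Σbinom n f) (Σbinom n g) (Σbinom n (f ∘ suc)) (Σbinom n (g ∘ suc)) ⟩
  (Σbinom n f + Σbinom n (f ∘ suc)) + (Σbinom n g + Σbinom n (g ∘ suc)) ∎
  where
  interchange : ∀ a b c d → (a + b) + (c + d) ≡ (a + c) + (b + d)
  interchange = solve-∀

Σbinom-*ˡ : ∀ n c (f : ℕ → ℤ) → Σbinom n (λ j → c * f j) ≡ c * Σbinom n f
Σbinom-*ˡ zero    c f = refl
Σbinom-*ˡ (suc n) c f =
  trans (cong₂ _+_ (Σbinom-*ˡ n c f) (Σbinom-*ˡ n c (f ∘ suc))) (sym (*-distribˡ-+ c _ _))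

Σbinom-absorb : ∀ n (f : ℕ → ℤ) → Σbinom (suc n) (λ j → + j * f j) ≡ + suc n * Σbinom n (f ∘ suc)
Σbinom-absorb zero    f = +-identityˡ (+ 1 * f 1)
Σbinom-absorb (suc n) f = begin
  Σbinom (suc n) (λ j → + j * f j) + Σbinom (suc n) (λ j → + suc j * f (suc j))
    ≡⟨ cong (λ y → Σbinom (suc n) (λ j → + j * f j) + y)
         (trans (Σbinom-cong (suc n) (λ j → suc-* (+ j) (f (suc j))))
                (Σbinom-+ (suc n) (λ j → + j * f (suc j)) (f ∘ suc))) ⟩
  Σbinom (suc n) (λ j → + j * f j) + (Σbinom (suc n) (λ j → + j * f (suc j)) + Σbinom (suc n) (f ∘ suc))
    ≡⟨ cong₂ (λ a b → a + (b + Σbinom (suc n) (f ∘ suc))) (Σbinom-absorb n f) (Σbinom-absorb n (f ∘ suc)) ⟩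
  + suc n * Σbinom n (f ∘ suc) + (+ suc n * Σbinom n (f ∘ suc ∘ suc) + Σbinom (suc n) (f ∘ suc))
    ≡⟨ collect (+ suc n) (Σbinom n (f ∘ suc)) (Σbinom n (f ∘ suc ∘ suc)) ⟩
  (+ 1 + + suc n) * (Σbinom n (f ∘ suc) + Σbinom n (f ∘ suc ∘ suc)) ∎
  where
  suc-* : ∀ j x → (+ 1 + j) * x ≡ j * x + x
  suc-* = solve-∀
  collect : ∀ k a b → k * a + (k * b + (a + b)) ≡ (+ 1 + k) * (a + b)
  collect = solve-∀

Σbinom-geometric : ∀ (b c s t : ℤ) (G : ℤ → ℤ) → (∀ k → G k + b * G (s + k) ≡ c * G (t + k)) →
  ∀ n m → Σbinom n (λ j → b ℤ.^ j * G (s * + j + m)) ≡ c ℤ.^ n * G (t * + n + m)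
Σbinom-geometric b c s t G step zero    m = cong (λ i → + 1 * G i) (index s t m)
  where
  index : ∀ s t m → s * + 0 + m ≡ t * + 0 + m
  index = solve-∀
Σbinom-geometric b c s t G step (suc n) m = begin
  Σbinom n (λ j → b ℤ.^ j * G (s * + j + m)) + Σbinom n (λ j → b ℤ.^ suc j * G (s * + suc j + m))
    ≡⟨ cong (λ y → Σbinom n (λ j → b ℤ.^ j * G (s * + j + m)) + y)
         (trans (Σbinom-cong n shift) (Σbinom-*ˡ n b _)) ⟩
  Σbinom n (λ j → b ℤ.^ j * G (s * + j + m)) + b * Σbinom n (λ j → b ℤ.^ j * G (s * + j + (s + m)))
    ≡⟨ cong₂ (λ x y → x + b * y) (Σbinom-geometric b c s t G step n m)
                                  (Σbinom-geometric b c s t G step n (s + m)) ⟩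
  c ℤ.^ n * G k + b * (c ℤ.^ n * G (t * + n + (s + m)))
    ≡⟨ cong (λ i → c ℤ.^ n * G k + b * (c ℤ.^ n * G i)) (index₂ t s (+ n) m) ⟩
  c ℤ.^ n * G k + b * (c ℤ.^ n * G (s + k))
    ≡⟨ factor (c ℤ.^ n) b (G k) (G (s + k)) ⟩
  c ℤ.^ n * (G k + b * G (s + k))
    ≡⟨ cong (c ℤ.^ n *_) (step k) ⟩
  c ℤ.^ n * (c * G (t + k))
    ≡⟨ trans (swap (c ℤ.^ n) c (G (t + k))) (cong (λ i → c * c ℤ.^ n * G i) (index₃ t (+ n) m)) ⟩
  c * c ℤ.^ n * G (t * + suc n + m) ∎
  where
  k = t * + n + m
  index₁ : ∀ s j m → s * (+ 1 + j) + m ≡ s * j + (s + m)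
  index₁ = solve-∀
  shift : ∀ j → b ℤ.^ suc j * G (s * + suc j + m) ≡ b * (b ℤ.^ j * G (s * + j + (s + m)))
  shift j = trans (cong (λ i → b ℤ.^ suc j * G i) (index₁ s (+ j) m)) (*-assoc b _ _)
  index₂ : ∀ t s n m → t * n + (s + m) ≡ s + (t * n + m)
  index₂ = solve-∀
  index₃ : ∀ t n m → t + (t * n + m) ≡ t * (+ 1 + n) + m
  index₃ = solve-∀
  factor : ∀ p b x y → p * x + b * (p * y) ≡ p * (x + b * y)
  factor = solve-∀
  swap : ∀ p c x → p * (c * x) ≡ c * p * x
  swap = solve-∀

pos-^ : ∀ a n → + (a ^ n) ≡ (+ a) ℤ.^ n
pos-^ a zero    = refl
pos-^ a (suc n) = trans (pos-* a (a ^ n)) (cong (λ x → + a * x) (pos-^ a n))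

neg-^ : ∀ i n → (- i) ℤ.^ n ≡ sgn n * i ℤ.^ n
neg-^ i zero    = refl
neg-^ i (suc n) = trans (cong (λ x → - i * x) (neg-^ i n)) (pull-sign i (sgn n) (i ℤ.^ n))
  where
  pull-sign : ∀ i s x → - i * (s * x) ≡ - s * (i * x)
  pull-sign = solve-∀

sgn≡-1^ : ∀ j → sgn j ≡ (- + 1) ℤ.^ j
sgn≡-1^ j = sym (trans (neg-^ (+ 1) j) (trans (cong (sgn j *_) (^-zeroˡ j)) (*-identityʳ (sgn j))))

4*[j/2]≡2*j-1+sgn[j] : ∀ j → + 4 * + (j / 2) ≡ + 2 * + j - + 1 + sgn j
4*[j/2]≡2*j-1+sgn[j] zero          = refl
4*[j/2]≡2*j-1+sgn[j] (suc zero)    = refl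
4*[j/2]≡2*j-1+sgn[j] (suc (suc j)) = begin
  + 4 * + (suc (suc j) / 2)
    ≡⟨ cong (λ q → + 4 * + q) (m/n≡1+[m∸n]/n {suc (suc j)} {2} (ℕ.s≤s (ℕ.s≤s ℕ.z≤n))) ⟩
  + 4 * (+ 1 + + (j / 2))
    ≡⟨ *-distribˡ-+ (+ 4) (+ 1) (+ (j / 2)) ⟩
  + 4 + + 4 * + (j / 2)
    ≡⟨ cong (λ x → + 4 + x) (4*[j/2]≡2*j-1+sgn[j] j) ⟩
  + 4 + (+ 2 * + j - + 1 + sgn j)
    ≡⟨ step (+ j) (sgn j) ⟩
  + 2 * (+ 1 + (+ 1 + + j)) - + 1 + - - sgn j ∎
  where
  step : ∀ j s → + 4 + (+ 2 * j - + 1 + s) ≡ + 2 * (+ 1 + (+ 1 + j)) - + 1 + - - s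
  step = solve-∀

module FibonacciLike (G : ℤ → ℤ) (G-rec : ∀ k → G (+ 2 + k) ≡ G (+ 1 + k) + G k) where

  G[k+3] : ∀ k → G (+ 3 + k) ≡ G (+ 2 + k) + G (+ 1 + k)
  G[k+3] k = begin
    G (+ 3 + k)                       ≡⟨ cong G (index₁ k) ⟩
    G (+ 2 + (+ 1 + k))               ≡⟨ G-rec (+ 1 + k) ⟩
    G (+ 1 + (+ 1 + k)) + G (+ 1 + k) ≡⟨ cong (λ i → G i + G (+ 1 + k)) (index₂ k) ⟩
    G (+ 2 + k) + G (+ 1 + k)         ∎
    where
    index₁ : ∀ k → + 3 + k ≡ + 2 + (+ 1 + k)
    index₁ = solve-∀
    index₂ : ∀ k → + 1 + (+ 1 + k) ≡ + 2 + k
    index₂ = solve-∀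

  G[k]+G[k+3] : ∀ k → G k + + 1 * G (+ 3 + k) ≡ + 2 * G (+ 2 + k)
  G[k]+G[k+3] k rewrite G[k+3] k | G-rec k = identity (G (+ 1 + k)) (G k)
    where
    identity : ∀ a b → b + + 1 * ((a + b) + a) ≡ + 2 * (a + b)
    identity = solve-∀

  G[k]-G[k+3] : ∀ k → G k + (- + 1) * G (+ 3 + k) ≡ (- + 2) * G (+ 1 + k)
  G[k]-G[k+3] k rewrite G[k+3] k | G-rec k = identity (G (+ 1 + k)) (G k)
    where
    identity : ∀ a b → b + (- + 1) * ((a + b) + a) ≡ (- + 2) * a
    identity = solve-∀

  G[3[j+1]+m] : ∀ m j → G (+ 3 * + suc j + m) ≡ G (+ 3 * + j + (+ 3 + m))
  G[3[j+1]+m] m j = cong G (index (+ j) m)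
    where
    index : ∀ j m → + 3 * (+ 1 + j) + m ≡ + 3 * j + (+ 3 + m)
    index = solve-∀

  Σbinom-G : ∀ n m → Σbinom n (λ j → G (+ 3 * + j + m)) ≡ + (2 ^ n) * G (+ 2 * + n + m)
  Σbinom-G n m = begin
    Σbinom n (λ j → G (+ 3 * + j + m))
      ≡⟨ Σbinom-cong n (λ j → sym (trans (cong (_* G (+ 3 * + j + m)) (^-zeroˡ j)) (*-identityˡ _))) ⟩
    Σbinom n (λ j → (+ 1) ℤ.^ j * G (+ 3 * + j + m))
      ≡⟨ Σbinom-geometric (+ 1) (+ 2) (+ 3) (+ 2) G G[k]+G[k+3] n m ⟩
    (+ 2) ℤ.^ n * G (+ 2 * + n + m)
      ≡⟨ cong (_* G (+ 2 * + n + m)) (sym (pos-^ 2 n)) ⟩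
    + (2 ^ n) * G (+ 2 * + n + m) ∎

  Σbinom-sgn-G : ∀ n m → Σbinom n (λ j → sgn j * G (+ 3 * + j + m)) ≡ sgn n * (+ (2 ^ n) * G (+ n + m))
  Σbinom-sgn-G n m = begin
    Σbinom n (λ j → sgn j * G (+ 3 * + j + m))
      ≡⟨ Σbinom-cong n (λ j → cong (_* G (+ 3 * + j + m)) (sgn≡-1^ j)) ⟩
    Σbinom n (λ j → (- + 1) ℤ.^ j * G (+ 3 * + j + m))
      ≡⟨ Σbinom-geometric (- + 1) (- + 2) (+ 3) (+ 1) G G[k]-G[k+3] n m ⟩
    (- + 2) ℤ.^ n * G (+ 1 * + n + m)
      ≡⟨ cong₂ _*_ (trans (neg-^ (+ 2) n) (cong (sgn n *_) (sym (pos-^ 2 n))))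
                   (cong G (index (+ n) m)) ⟩
    sgn n * + (2 ^ n) * G (+ n + m)
      ≡⟨ *-assoc (sgn n) _ _ ⟩
    sgn n * (+ (2 ^ n) * G (+ n + m)) ∎
    where
    index : ∀ n m → + 1 * n + m ≡ n + m
    index = solve-∀

  Σbinom-j-G : ∀ n m → + 2 * Σbinom n (λ j → + j * G (+ 3 * + j + m))
                     ≡ + n * (+ (2 ^ n) * G (+ 2 * + n + + 1 + m))
  Σbinom-j-G zero    m = refl
  Σbinom-j-G (suc n) m = begin
    + 2 * Σbinom (suc n) (λ j → + j * G (+ 3 * + j + m))
      ≡⟨ cong (+ 2 *_) (Σbinom-absorb n _) ⟩
    + 2 * (+ suc n * Σbinom n (λ j → G (+ 3 * + suc j + m)))
      ≡⟨ cong (λ x → + 2 * (+ suc n * x)) (trans (Σbinom-cong n (G[3[j+1]+m] m)) (Σbinom-G n (+ 3 + m))) ⟩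
    + 2 * (+ suc n * (+ (2 ^ n) * G (+ 2 * + n + (+ 3 + m))))
      ≡⟨ cong (λ i → + 2 * (+ suc n * (+ (2 ^ n) * G i))) (index (+ n) m) ⟩
    + 2 * (+ suc n * (+ (2 ^ n) * G (+ 2 * (+ 1 + + n) + + 1 + m)))
      ≡⟨ trans (rearrange (+ suc n) (+ (2 ^ n)) x) (cong (λ p → + suc n * (p * x)) (sym (pos-* 2 (2 ^ n)))) ⟩
    + suc n * (+ (2 ^ suc n) * G (+ 2 * + suc n + + 1 + m)) ∎
    where
    x = G (+ 2 * + suc n + + 1 + m)
    index : ∀ n m → + 2 * n + (+ 3 + m) ≡ + 2 * (+ 1 + n) + + 1 + m
    index = solve-∀
    rearrange : ∀ k p x → + 2 * (k * (p * x)) ≡ k * (+ 2 * p * x)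
    rearrange = solve-∀

  Σbinom-[j/2]-G : ∀ n m → + 4 * Σbinom n (λ j → + (j / 2) * G (+ 3 * + j + m))
                 ≡ + (2 ^ n) * (+ n * G (+ 2 * + n + + 1 + m) - G (+ 2 * + n + m) + sgn n * G (+ n + m))
  Σbinom-[j/2]-G n m = begin
    + 4 * Σbinom n (λ j → + (j / 2) * g j)
      ≡⟨ sym (Σbinom-*ˡ n (+ 4) _) ⟩
    Σbinom n (λ j → + 4 * (+ (j / 2) * g j))
      ≡⟨ Σbinom-cong n split ⟩
    Σbinom n (λ j → + 2 * (+ j * g j) + ((- + 1) * g j + sgn j * g j))
      ≡⟨ trans (Σbinom-+ n _ _) (cong₂ _+_ (Σbinom-*ˡ n (+ 2) _) (trans (Σbinom-+ n _ _)
           (cong (_+ Σbinom n (λ j → sgn j * g j)) (Σbinom-*ˡ n (- + 1) g)))) ⟩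
    + 2 * Σbinom n (λ j → + j * g j) + ((- + 1) * Σbinom n g + Σbinom n (λ j → sgn j * g j))
      ≡⟨ cong₂ _+_ (Σbinom-j-G n m) (cong₂ (λ a b → (- + 1) * a + b) (Σbinom-G n m) (Σbinom-sgn-G n m)) ⟩
    + n * (p * G (+ 2 * + n + + 1 + m)) + ((- + 1) * (p * G (+ 2 * + n + m)) + sgn n * (p * G (+ n + m)))
      ≡⟨ factor (+ n) p (G (+ 2 * + n + + 1 + m)) (G (+ 2 * + n + m)) (sgn n) (G (+ n + m)) ⟩
    p * (+ n * G (+ 2 * + n + + 1 + m) - G (+ 2 * + n + m) + sgn n * G (+ n + m)) ∎
    where
    g : ℕ → ℤ
    g j = G (+ 3 * + j + m)
    p = + (2 ^ n)
    expand : ∀ j s x → (+ 2 * j - + 1 + s) * x ≡ + 2 * (j * x) + ((- + 1) * x + s * x)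
    expand = solve-∀
    split : ∀ j → + 4 * (+ (j / 2) * g j) ≡ + 2 * (+ j * g j) + ((- + 1) * g j + sgn j * g j)
    split j = trans (sym (*-assoc (+ 4) (+ (j / 2)) (g j)))
                    (trans (cong (_* g j) (4*[j/2]≡2*j-1+sgn[j] j)) (expand (+ j) (sgn j) (g j)))
    factor : ∀ n p a b s c → n * (p * a) + ((- + 1) * (p * b) + s * (p * c)) ≡ p * (n * a - b + s * c)
    factor = solve-∀

  binomial-[j/2]-sum : ∀ m n →
    + 4 * sumFrom1 n (λ j → + (n C j) * + (j / 2) * G (+ (3 ℕ.* j) + m))
      ≡ + (2 ^ n) * (+ n * G (+ (2 ℕ.* n ℕ.+ 1) + m) - G (+ (2 ℕ.* n) + m) + sgn n * G (+ n + m))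
  binomial-[j/2]-sum m n = begin
    + 4 * sumFrom1 n (λ j → + (n C j) * + (j / 2) * G (+ (3 ℕ.* j) + m))
      ≡⟨ cong (+ 4 *_) (sumFrom1-cong n (λ j → trans (*-assoc (+ (n C j)) _ _)
           (cong (λ i → + (n C j) * (+ (j / 2) * G (i + m))) (pos-* 3 j)))) ⟩
    + 4 * sumFrom1 n (λ j → + (n C j) * (+ (j / 2) * G (+ 3 * + j + m)))
      ≡⟨ cong (+ 4 *_) (sumFrom1≡Σbinom n _ refl) ⟩
    + 4 * Σbinom n (λ j → + (j / 2) * G (+ 3 * + j + m))
      ≡⟨ Σbinom-[j/2]-G n m ⟩
    + (2 ^ n) * (+ n * G (+ 2 * + n + + 1 + m) - G (+ 2 * + n + m) + sgn n * G (+ n + m))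
      ≡⟨ cong₂ (λ a b → + (2 ^ n) * (+ n * G (a + m) - G (b + m) + sgn n * G (+ n + m)))
               (trans (cong (_+ + 1) 2n≡2*n) (sym (pos-+ (2 ℕ.* n) 1))) 2n≡2*n ⟩
    + (2 ^ n) * (+ n * G (+ (2 ℕ.* n ℕ.+ 1) + m) - G (+ (2 ℕ.* n) + m) + sgn n * G (+ n + m)) ∎
    where
    2n≡2*n : + 2 * + n ≡ + (2 ℕ.* n)
    2n≡2*n = sym (pos-* 2 n)

-- At negative indices F and L alternate in sign (F₋ₖ = (−1)^(k+1) Fₖ, L₋ₖ = (−1)^k Lₖ),
-- which turns the recurrence into this identity with s = ±1.
alternating-recurrence : ∀ s a b → s * b ≡ - s * a + - - s * (a + b)
alternating-recurrence = solve-∀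

F-rec : ∀ k → F (+ 2 + k) ≡ F (+ 1 + k) + F k
F-rec (+ n)                = refl
F-rec -[1+ 0 ]             = refl
F-rec -[1+ 1 ]             = refl
F-rec -[1+ suc (suc t) ]   = alternating-recurrence (sgn t) (+ fibℕ (suc (suc t))) (+ fibℕ (suc t))

L-rec : ∀ k → L (+ 2 + k) ≡ L (+ 1 + k) + L k
L-rec (+ n)                = refl
L-rec -[1+ 0 ]             = refl
L-rec -[1+ 1 ]             = refl
L-rec -[1+ suc (suc t) ]   = alternating-recurrence (sgn (suc t)) (+ lucℕ (suc (suc t))) (+ lucℕ (suc t))

theorem18 : (m : ℤ) (n : ℕ) → ℕ.NonZero n →
    ((+ 4 * sumFrom1 n (λ j → + (n C j) * + (j / 2) * F (+ (3 ℕ.* j) + m)))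
      ≡ + (2 ^ n) * (+ n * F (+ (2 ℕ.* n ℕ.+ 1) + m) - F (+ (2 ℕ.* n) + m) + sgn n * F (+ n + m)))
    × ((+ 4 * sumFrom1 n (λ j → + (n C j) * + (j / 2) * L (+ (3 ℕ.* j) + m)))
      ≡ + (2 ^ n) * (+ n * L (+ (2 ℕ.* n ℕ.+ 1) + m) - L (+ (2 ℕ.* n) + m) + sgn n * L (+ n + m)))
theorem18 m n _ = FibonacciLike.binomial-[j/2]-sum F F-rec m n , FibonacciLike.binomial-[j/2]-sum L L-rec m n
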